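{- For indeterminates $s,t$ and positive integers $n$ define $$\mathrm{SgnBDes}^D_n(s,t)=\sum_{\pi\in\mathfrak{D}_n}(-1)^{\mathrm{inv}_D(\pi)}s^{\mathrm{asc}_B(\pi)}t^{\mathrm{des}_B(\pi)},\qquad \mathrm{SgnBDes}^{B-D}_n(s,t)=\sum_{\pi\in\mathfrak{B}_n\setminus\mathfrak{D}_n}(-1)^{\mathrm{inv}_D(\pi)}s^{\mathrm{asc}_B(\pi)}t^{\mathrm{des}_B(\pi)}.$$ Then for positive integers $n\ge 2$ (with $\mathrm{SgnBDes}^D_0=1$, $\mathrm{SgnBDes}^{B-D}_0=0$ understood when $n=2$ if needed), $$\mathrm{SgnBDes}^D_n(s,t)=(s-t)^2\,\mathrm{SgnBDes}^D_{n-2}(s,t),\qquad \mathrm{SgnBDes}^{B-D}_n(s,t)=(s-t)^2\,\mathrm{SgnBDes}^{B-D}_{n-2}(s,t),$$ and consequently $$\mathrm{SgnBDes}^D_n(s,t)=\begin{cases}(s-t)^n & n\text{ even},\\ s(s-t)^{n-1} & n\text{ odd},\end{cases}\qquad \mathrm{SgnBDes}^{B-D}_n(s,t)=\begin{cases}0 & n\text{ even},\\ t(s-t)^{n-1} & n\text{ odd}.\end{cases}$$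
   Context: $\mathfrak{B}_n$ is the group of signed permutations of $\{\pm1,\dots,\pm n\}$, written $\pi=\pi_1\cdots\pi_n$ with $\pi_i=\pi(i)$. $\mathrm{negs}(\pi)=|\{i:\pi_i<0\}|$; $\mathfrak{D}_n=\{\pi\in\mathfrak{B}_n:\mathrm{negs}(\pi)\text{ even}\}$. For $\pi\in\mathfrak{B}_n$, $\mathrm{inv}_D(\pi)=|\{1\le i<j\le n:\pi_i>\pi_j\}|+|\{1\le i<j\le n:-\pi_i>\pi_j\}|$. With $\pi_0=0$, $\mathrm{des}_B(\pi)=|\{i\in\{0,\dots,n-1\}:\pi_i>\pi_{i+1}\}|$ and $\mathrm{asc}_B(\pi)=n-\mathrm{des}_B(\pi)$. -}

module Defs where

open import Level using (Level)
open import Data.Bool using (Bool; true; false; if_then_else_)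
open import Data.Nat using (ℕ; zero; suc; _∸_) renaming (_+_ to _+ℕ_)
import Data.Nat as ℕ
open import Data.Nat.Properties using () renaming (_≟_ to _≟ℕ_)
import Data.Integer as ℤ
open import Data.Integer using (ℤ; +_; ∣_∣; _<?_)

open import Relation.Nullary using (Dec; yes; no; does)

_<ᵇ_ : ℤ → ℤ → Bool
x <ᵇ y = does (x <? y)
infix 4 _<ᵇ_
open import Data.List using (List; []; _∷_; map; concatMap; applyUpTo; _++_; filter; length; foldr)
open import Data.List.Relation.Unary.Unique.DecPropositional _≟ℕ_ using (Unique; unique?)
open import Algebra.Bundles using (CommutativeRing)

-- Signed permutations of {±1,…,±n}, as words π₁⋯πₙ (lists of integers).

alphabet : ℕ → List ℤ
alphabet n = applyUpTo (λ i → ℤ.- (+ suc i)) n ++ applyUpTo (λ i → + suc i) n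

words : {A : Set} → ℕ → List A → List (List A)
words zero    as = [] ∷ []
words (suc k) as = concatMap (λ a → map (a ∷_) (words k as)) as

B : ℕ → List (List ℤ)
B n = filter (λ w → unique? (map ∣_∣ w)) (words n (alphabet n))

count : {A : Set} → (A → Bool) → List A → ℕ
count p []       = 0
count p (x ∷ xs) = (if p x then 1 else 0) +ℕ count p xs

negs : List ℤ → ℕ
negs = count (λ x → x <ᵇ (+ 0))

even : ℕ → Bool
even zero          = true
even (suc zero)    = false
even (suc (suc n)) = even n

D : ℕ → List (List ℤ)
D n = filter (λ w → Data.Bool.T? (even (negs w))) (B n)
  where import Data.Bool

BminusD : ℕ → List (List ℤ)
BminusD n = filter (λ w → Data.Bool.T? (Data.Bool.not (even (negs w)))) (B n)
  where import Data.Bool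

invD : List ℤ → ℕ
invD []       = 0
invD (x ∷ xs) = count (λ y → y <ᵇ x) xs +ℕ count (λ y → y <ᵇ ℤ.- x) xs +ℕ invD xs

desFrom : ℤ → List ℤ → ℕ
desFrom prev []       = 0
desFrom prev (x ∷ xs) = (if (x <ᵇ prev) then 1 else 0) +ℕ desFrom x xs

desB : List ℤ → ℕ
desB = desFrom (+ 0)

ascB : List ℤ → ℕ
ascB w = length w ∸ desB w

-- The signed generating functions, evaluated in an arbitrary commutative
-- ring at arbitrary elements s t (this is how we render "indeterminates").

module _ {c ℓ : Level} (R : CommutativeRing c ℓ) where
  open CommutativeRing R using (Carrier; _+_; _*_; -_; 0#; 1#)

  pow : Carrier → ℕ → Carrier
  pow x zero    = 1#
  pow x (suc k) = x * pow x k

  sumR : List Carrier → Carrier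
  sumR = foldr _+_ 0#

  term : Carrier → Carrier → List ℤ → Carrier
  term s t w = pow (- 1#) (invD w) * pow s (ascB w) * pow t (desB w)

  SgnBDesD : ℕ → Carrier → Carrier → Carrier
  SgnBDesD n s t = sumR (map (term s t) (D n))

  SgnBDesBD : ℕ → Carrier → Carrier → Carrier
  SgnBDesBD n s t = sumR (map (term s t) (BminusD n))

-- Since the absolute values of a signed permutation are distinct, inv_D(π) has the parity of
-- the number of inversions of |π₁|⋯|πₙ|, and s^asc t^des is a product of one factor (s for an
-- ascent, t for a descent) per step πᵢ₋₁ → πᵢ. Building π letter by letter, the signed sum over
-- all completions of a prefix therefore depends only on the number k of unused values, on the
-- rank among them of the last letter and on its sign: this is the recursion Ψ. Solving it, Ψ with
-- k + 1 letters to place is a coefficient times (s - t)^k, and only ranks 0 and 1 of the last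
-- letter give non-zero coefficients; every two further letters contribute a factor (s - t)².

module Submission where

open import Defs
open import Level using (Level)
import Data.Nat as ℕ
open import Data.Nat using (ℕ)
open import Data.Product using (_×_)
open import Algebra.Bundles using (CommutativeRing)

module Combinatorics where
  open import Data.Nat
    using (ℕ; zero; suc; _+_; _*_; _∸_; _≤_; _<_; _≡ᵇ_)
    renaming (_<ᵇ_ to _<ᵇℕ_)
  import Data.Nat.Properties as ℕP
  open import Data.Nat.Tactic.RingSolver using (solve-∀)
  open import Data.Bool using (Bool; true; false; if_then_else_; not; _∧_; _∨_; T)
  import Data.Bool.Properties as BoolP
  import Data.Integer as ℤ
  open import Data.Integer using (ℤ; +_; -[1+_]; ∣_∣)
  open import Data.List using (List; []; _∷_; map; _++_; _∷ʳ_)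
  import Data.List.Properties as ListP
  import Data.List.Relation.Unary.All as All
  open import Data.List.Relation.Unary.Unique.DecPropositional ℕP._≟_ using (unique?)
  open import Data.Empty using (⊥-elim)
  open import Data.Sum using (inj₁; inj₂)
  open import Function.Bundles using (Equivalence)
  open import Function.Base using (_∘_)
  open import Relation.Binary.Definitions using (tri<; tri≈; tri>)
  open import Relation.Nullary using (does; ¬?)
  open import Relation.Binary.PropositionalEquality
    using (_≡_; _≢_; refl; sym; trans; cong; cong₂; subst)
  open import Algebra.Properties.CommutativeSemigroup ℕP.+-commutativeSemigroup
    using (interchange; xy∙z≈xz∙y)

  infix 4 _∈ᵇ_

  _∈ᵇ_ : ℕ → List ℕ → Bool
  x ∈ᵇ []       = false
  x ∈ᵇ (y ∷ ys) = (x ≡ᵇ y) ∨ (x ∈ᵇ ys)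

  uniqueᵇ : List ℕ → Bool
  uniqueᵇ []       = true
  uniqueᵇ (x ∷ xs) = not (x ∈ᵇ xs) ∧ uniqueᵇ xs

  does-unique? : ∀ xs → does (unique? xs) ≡ uniqueᵇ xs
  does-unique? []       = refl
  does-unique? (x ∷ xs) = cong₂ _∧_ (does-all≢ xs) (does-unique? xs)
    where
    does-all≢ : ∀ ys → does (All.all? (λ y → ¬? (x ℕP.≟ y)) ys) ≡ not (x ∈ᵇ ys)
    does-all≢ []       = refl
    does-all≢ (y ∷ ys) with x ≡ᵇ y
    ... | true  = refl
    ... | false = does-all≢ ys

  ≡ᵇ-refl : ∀ x → (x ≡ᵇ x) ≡ true
  ≡ᵇ-refl zero    = refl
  ≡ᵇ-refl (suc x) = ≡ᵇ-refl x

  ≡ᵇ-≢ : ∀ {x y} → x ≢ y → (x ≡ᵇ y) ≡ false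
  ≡ᵇ-≢ {x} {y} x≢y with x ≡ᵇ y in eq
  ... | true  = ⊥-elim (x≢y (ℕP.≡ᵇ⇒≡ x y (subst T (sym eq) _)))
  ... | false = refl

  ∈ᵇ-≢ : ∀ U {a b} → (a ∈ᵇ U) ≡ false → (b ∈ᵇ U) ≡ true → a ≢ b
  ∈ᵇ-≢ U a∉U b∈U refl with () ← trans (sym a∉U) b∈U

  ∈ᵇ-∷ʳ : ∀ v U m → (v ∈ᵇ U ∷ʳ m) ≡ (v ∈ᵇ U) ∨ (v ≡ᵇ m)
  ∈ᵇ-∷ʳ v []      m = BoolP.∨-identityʳ (v ≡ᵇ m)
  ∈ᵇ-∷ʳ v (u ∷ U) m =
    trans (cong ((v ≡ᵇ u) ∨_) (∈ᵇ-∷ʳ v U m)) (sym (BoolP.∨-assoc (v ≡ᵇ u) (v ∈ᵇ U) (v ≡ᵇ m)))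

  ∈ᵇ-∷ʳ-≢ : ∀ {v m} U → v ≢ m → (v ∈ᵇ U ∷ʳ m) ≡ (v ∈ᵇ U)
  ∈ᵇ-∷ʳ-≢ {v} {m} U v≢m =
    trans (∈ᵇ-∷ʳ v U m) (trans (cong ((v ∈ᵇ U) ∨_) (≡ᵇ-≢ v≢m)) (BoolP.∨-identityʳ (v ∈ᵇ U)))

  ∈ᵇ-∷ʳ-self : ∀ U m → (m ∈ᵇ U ∷ʳ m) ≡ true
  ∈ᵇ-∷ʳ-self U m =
    trans (∈ᵇ-∷ʳ m U m) (trans (cong ((m ∈ᵇ U) ∨_) (≡ᵇ-refl m)) (BoolP.∨-zeroʳ (m ∈ᵇ U)))

  ∈ᵇ-++-∷-self : ∀ x U ys → (x ∈ᵇ U ++ x ∷ ys) ≡ true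
  ∈ᵇ-++-∷-self x []      ys rewrite ≡ᵇ-refl x = refl
  ∈ᵇ-++-∷-self x (u ∷ U) ys rewrite ∈ᵇ-++-∷-self x U ys = BoolP.∨-zeroʳ (x ≡ᵇ u)

  uniqueᵇ-++-∷-∈ : ∀ x U ys → (x ∈ᵇ U) ≡ true → uniqueᵇ (U ++ x ∷ ys) ≡ false
  uniqueᵇ-++-∷-∈ x (u ∷ U) ys x∈U with x ≡ᵇ u in x≡u
  ... | true rewrite ℕP.≡ᵇ⇒≡ x u (subst T (sym x≡u) _) | ∈ᵇ-++-∷-self u U ys = refl
  ... | false rewrite uniqueᵇ-++-∷-∈ x U ys x∈U = BoolP.∧-zeroʳ _

  uniqueᵇ-++-∷ : ∀ x U ys → uniqueᵇ (U ++ x ∷ ys) ≡ not (x ∈ᵇ U) ∧ uniqueᵇ (U ∷ʳ x ++ ys)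
  uniqueᵇ-++-∷ x U ys with x ∈ᵇ U in x∈U
  ... | true  = uniqueᵇ-++-∷-∈ x U ys x∈U
  ... | false = cong uniqueᵇ (sym (ListP.∷ʳ-++ U x ys))

  ≡ᵇ-sym : ∀ x y → (x ≡ᵇ y) ≡ (y ≡ᵇ x)
  ≡ᵇ-sym zero    zero    = refl
  ≡ᵇ-sym zero    (suc y) = refl
  ≡ᵇ-sym (suc x) zero    = refl
  ≡ᵇ-sym (suc x) (suc y) = ≡ᵇ-sym x y

  uniqueᵇ-∷ʳ : ∀ U m → uniqueᵇ U ≡ true → (m ∈ᵇ U) ≡ false → uniqueᵇ (U ∷ʳ m) ≡ true
  uniqueᵇ-∷ʳ []      m _  _ = refl
  uniqueᵇ-∷ʳ (u ∷ U) m uU m∉U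
    with u ∈ᵇ U in u∈U | uniqueᵇ U in uU′ | m ≡ᵇ u in m≡u | m ∈ᵇ U in m∈U
  ... | false | true | false | false
    rewrite ∈ᵇ-∷ʳ u U m | u∈U | ≡ᵇ-sym u m | m≡u | uniqueᵇ-∷ʳ U m uU′ m∈U = refl

  𝟙 : Bool → ℕ
  𝟙 b = if b then 1 else 0

  count-∷ʳ : {A : Set} (p : A → Bool) (U : List A) (m : A) → count p (U ∷ʳ m) ≡ count p U + 𝟙 (p m)
  count-∷ʳ p []      m = ℕP.+-identityʳ _
  count-∷ʳ p (u ∷ U) m rewrite count-∷ʳ p U m = sym (ℕP.+-assoc (𝟙 (p u)) (count p U) _)

  <ᵇ-true : ∀ {m n} → m < n → (m <ᵇℕ n) ≡ true
  <ᵇ-true m<n = Equivalence.to BoolP.T-≡ (ℕP.<⇒<ᵇ m<n)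

  <ᵇ-false : ∀ {m n} → n ≤ m → (m <ᵇℕ n) ≡ false
  <ᵇ-false {m} {n} n≤m with m <ᵇℕ n in eq
  ... | false = refl
  ... | true  = ⊥-elim (ℕP.<⇒≱ (ℕP.<ᵇ⇒< m n (subst T (sym eq) _)) n≤m)

  -- Values not yet used: freeUpTo U j counts the v ∈ {1,…,j} with v ∉ U, so that
  -- rank U v is the position of v among the free values.

  freeUpTo : List ℕ → ℕ → ℕ
  freeUpTo U zero    = 0
  freeUpTo U (suc j) = freeUpTo U j + (if suc j ∈ᵇ U then 0 else 1)

  rank : List ℕ → ℕ → ℕ
  rank U v = freeUpTo U (v ∸ 1)

  freeUpTo-[] : ∀ j → freeUpTo [] j ≡ j
  freeUpTo-[] zero    = refl
  freeUpTo-[] (suc j) rewrite freeUpTo-[] j = ℕP.+-comm j 1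

  freeUpTo-mono : ∀ U {i j} → i ≤ j → freeUpTo U i ≤ freeUpTo U j
  freeUpTo-mono U {i} {j} i≤j with ℕP.m≤n⇒m<n∨m≡n i≤j
  ... | inj₂ refl = ℕP.≤-refl
  freeUpTo-mono U {i} {suc j} i≤j | inj₁ i<1+j =
    ℕP.≤-trans (freeUpTo-mono U (ℕP.≤-pred i<1+j)) (ℕP.m≤m+n _ _)

  freeUpTo-suc-free : ∀ U i → (suc i ∈ᵇ U) ≡ false → freeUpTo U (suc i) ≡ suc (freeUpTo U i)
  freeUpTo-suc-free U i free rewrite free = ℕP.+-comm _ 1

  freeUpTo-∷ʳ-< : ∀ U {m} j → j < m → freeUpTo (U ∷ʳ m) j ≡ freeUpTo U j
  freeUpTo-∷ʳ-< U zero    j<m = refl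
  freeUpTo-∷ʳ-< U (suc j) j<m
    rewrite freeUpTo-∷ʳ-< U j (ℕP.<-trans (ℕP.n<1+n j) j<m)
          | ∈ᵇ-∷ʳ-≢ {suc j} U (ℕP.<⇒≢ j<m) = refl

  freeUpTo-∷ʳ-≥ : ∀ U {i} j → suc i ≤ j → (suc i ∈ᵇ U) ≡ false →
                  suc (freeUpTo (U ∷ʳ suc i) j) ≡ freeUpTo U j
  freeUpTo-∷ʳ-≥ U (suc j) i<j free with ℕP.m≤n⇒m<n∨m≡n i<j
  ... | inj₂ refl
    rewrite freeUpTo-∷ʳ-< U j (ℕP.n<1+n j) | ∈ᵇ-∷ʳ-self U (suc j) | free
    = trans (cong suc (ℕP.+-identityʳ _)) (ℕP.+-comm 1 _)
  ... | inj₁ i<1+j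
    rewrite ∈ᵇ-∷ʳ-≢ {suc j} U (ℕP.<⇒≢ i<1+j ∘ sym)
    = cong (_+ (if suc j ∈ᵇ U then 0 else 1)) (freeUpTo-∷ʳ-≥ U j (ℕP.≤-pred i<1+j) free)

  rank-<ᵇ : ∀ U i q → (suc i ∈ᵇ U) ≡ false → suc i ≢ q →
            (suc i <ᵇℕ q) ≡ (rank U (suc i) <ᵇℕ rank U q)
  rank-<ᵇ U i q free i≢q with ℕP.<-cmp (suc i) q
  ... | tri≈ _ i≡q _ = ⊥-elim (i≢q i≡q)
  ... | tri< i<q _ _ = trans (<ᵇ-true i<q) (sym (<ᵇ-true (ℕP.<-≤-trans
          (subst (freeUpTo U i <_) (sym (freeUpTo-suc-free U i free)) ℕP.≤-refl)
          (freeUpTo-mono U (ℕP.∸-monoˡ-≤ 1 i<q)))))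
  ... | tri> _ _ q<i = trans (<ᵇ-false (ℕP.<⇒≤ q<i)) (sym (<ᵇ-false
          (freeUpTo-mono U (ℕP.≤-trans (ℕP.m∸n≤m q 1) (ℕP.≤-pred q<i)))))

  -- pendingInv U j counts the pairs (u, v) with u ∈ U, v ∈ {1,…,j} ∖ U and v < u:
  -- the inversions that the used values U will form with the values still to come.

  pendingAt : List ℕ → ℕ → ℕ
  pendingAt U v = if v ∈ᵇ U then 0 else count (v <ᵇℕ_) U

  pendingInv : List ℕ → ℕ → ℕ
  pendingInv U zero    = 0
  pendingInv U (suc j) = pendingInv U j + pendingAt U (suc j)

  pendingInv-[] : ∀ j → pendingInv [] j ≡ 0
  pendingInv-[] zero    = refl
  pendingInv-[] (suc j) rewrite pendingInv-[] j = refl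

  pendingInv-no-free : ∀ U j → freeUpTo U j ≡ 0 → pendingInv U j ≡ 0
  pendingInv-no-free U zero    _ = refl
  pendingInv-no-free U (suc j) none with suc j ∈ᵇ U
  ... | true  rewrite pendingInv-no-free U j (trans (sym (ℕP.+-identityʳ _)) none) = refl
  ... | false = ⊥-elim (ℕP.1+n≢0 (trans (ℕP.+-comm 1 _) none))

  pendingAt-∷ʳ-> : ∀ U {m} v → v < m → pendingAt (U ∷ʳ m) v ≡ pendingAt U v + (if v ∈ᵇ U then 0 else 1)
  pendingAt-∷ʳ-> U {m} v v<m
    rewrite ∈ᵇ-∷ʳ-≢ {v} U (ℕP.<⇒≢ v<m) | count-∷ʳ (v <ᵇℕ_) U m | <ᵇ-true v<m with v ∈ᵇ U
  ... | true  = refl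
  ... | false = refl

  pendingAt-∷ʳ-< : ∀ U {m} v → m < v → pendingAt (U ∷ʳ m) v ≡ pendingAt U v
  pendingAt-∷ʳ-< U {m} v m<v
    rewrite ∈ᵇ-∷ʳ-≢ {v} U (ℕP.<⇒≢ m<v ∘ sym) | count-∷ʳ (v <ᵇℕ_) U m | <ᵇ-false (ℕP.<⇒≤ m<v)
    with v ∈ᵇ U
  ... | true  = refl
  ... | false = ℕP.+-identityʳ _

  pendingInv-∷ʳ-< : ∀ U {m} j → j < m → pendingInv (U ∷ʳ m) j ≡ pendingInv U j + freeUpTo U j
  pendingInv-∷ʳ-< U zero    j<m = refl
  pendingInv-∷ʳ-< U (suc j) j<m
    rewrite pendingInv-∷ʳ-< U j (ℕP.<-trans (ℕP.n<1+n j) j<m) | pendingAt-∷ʳ-> U (suc j) j<m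
    = interchange (pendingInv U j) _ _ _

  -- Appending v trades the count(v <_) U new inversions for the pending ones at v.
  pendingInv-∷ʳ : ∀ U {i} j → suc i ≤ j → (suc i ∈ᵇ U) ≡ false →
                  pendingInv (U ∷ʳ suc i) j + count (suc i <ᵇℕ_) U ≡ pendingInv U j + rank U (suc i)
  pendingInv-∷ʳ U {i} (suc j) i<j free with ℕP.m≤n⇒m<n∨m≡n i<j
  ... | inj₂ refl
    rewrite pendingInv-∷ʳ-< U j (ℕP.n<1+n j) | ∈ᵇ-∷ʳ-self U (suc j) | free
    = trans (cong (_+ count (suc j <ᵇℕ_) U) (ℕP.+-identityʳ _)) (xy∙z≈xz∙y (pendingInv U j) _ _)
  ... | inj₁ i<1+j
    rewrite pendingAt-∷ʳ-< U (suc j) i<1+j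
    = trans (xy∙z≈xz∙y (pendingInv (U ∷ʳ suc i) j) _ _)
            (trans (cong (_+ pendingAt U (suc j)) (pendingInv-∷ʳ U j (ℕP.≤-pred i<1+j) free))
                   (xy∙z≈xz∙y (pendingInv U j) _ _))

  inv : List ℕ → ℕ
  inv []       = 0
  inv (x ∷ xs) = count (_<ᵇℕ x) xs + inv xs

  -- x before y with y negative and |x| < |y|: such pairs count twice in inv_D
  negAbove : ℤ → ℤ → Bool
  negAbove x y = (y <ᵇ + 0) ∧ (∣ x ∣ <ᵇℕ ∣ y ∣)

  negAboveCount : List ℤ → ℕ
  negAboveCount []       = 0
  negAboveCount (x ∷ xs) = count (negAbove x) xs + negAboveCount xs

  +-*2-interchange : ∀ a b c d → (a + 2 * b) + (c + 2 * d) ≡ (a + c) + 2 * (b + d)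
  +-*2-interchange = solve-∀

  <ᵇ-total-parity : ∀ {a b} → a ≢ b → 𝟙 (b <ᵇℕ a) + 1 ≡ 𝟙 (a <ᵇℕ b) + 2 * 𝟙 (b <ᵇℕ a)
  <ᵇ-total-parity {a} {b} a≢b with ℕP.<-cmp a b
  ... | tri≈ _ a≡b _ = ⊥-elim (a≢b a≡b)
  ... | tri< a<b _ _ rewrite <ᵇ-true a<b | <ᵇ-false (ℕP.<⇒≤ a<b) = refl
  ... | tri> _ _ b<a rewrite <ᵇ-true b<a | <ᵇ-false (ℕP.<⇒≤ b<a) = refl

  invD-pair : ∀ y x → ∣ y ∣ ≢ ∣ x ∣ →
              𝟙 (y <ᵇ x) + 𝟙 (y <ᵇ ℤ.- x) ≡ 𝟙 (∣ y ∣ <ᵇℕ ∣ x ∣) + 2 * 𝟙 (negAbove x y)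
  invD-pair (+ zero)  (+ zero)  ne = ⊥-elim (ne refl)
  invD-pair (+ zero)  (+ suc b) ne = refl
  invD-pair (+ zero)  -[1+ b ]  ne = refl
  invD-pair (+ suc a) (+ zero)  ne = refl
  invD-pair (+ suc a) (+ suc b) ne = refl
  invD-pair (+ suc a) -[1+ b ]  ne = sym (ℕP.+-identityʳ _)
  invD-pair -[1+ a ]  (+ zero)  ne = refl
  invD-pair -[1+ a ]  (+ suc b) ne = trans (ℕP.+-comm 1 _) (<ᵇ-total-parity (ne ∘ cong suc))
  invD-pair -[1+ a ]  -[1+ b ]  ne = <ᵇ-total-parity (ne ∘ cong suc)

  invD-count : ∀ x xs → (∣ x ∣ ∈ᵇ map ∣_∣ xs) ≡ false →
               count (_<ᵇ x) xs + count (_<ᵇ ℤ.- x) xs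
               ≡ count (_<ᵇℕ ∣ x ∣) (map ∣_∣ xs) + 2 * count (negAbove x) xs
  invD-count x []       _ = refl
  invD-count x (y ∷ ys) x∉ with ∣ x ∣ ≡ᵇ ∣ y ∣ in x≡y
  ... | false = trans (interchange (𝟙 (y <ᵇ x)) _ _ _)
                 (trans (cong₂ _+_ (invD-pair y x y≢x) (invD-count x ys x∉))
                        (+-*2-interchange (𝟙 (∣ y ∣ <ᵇℕ ∣ x ∣)) (𝟙 (negAbove x y)) _ _))
    where
    y≢x : ∣ y ∣ ≢ ∣ x ∣
    y≢x y≡x with () ← trans (sym x≡y) (trans (cong (∣ x ∣ ≡ᵇ_) y≡x) (≡ᵇ-refl ∣ x ∣))

  invD-parity : ∀ w → uniqueᵇ (map ∣_∣ w) ≡ true → invD w ≡ inv (map ∣_∣ w) + 2 * negAboveCount w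
  invD-parity []       _ = refl
  invD-parity (x ∷ xs) u with ∣ x ∣ ∈ᵇ map ∣_∣ xs in x∉ | uniqueᵇ (map ∣_∣ xs) in uxs
  ... | false | true = trans (cong₂ _+_ (invD-count x xs x∉) (invD-parity xs uxs))
                            (+-*2-interchange (count (_<ᵇℕ ∣ x ∣) (map ∣_∣ xs)) (count (negAbove x) xs) _ _)

  invAfter : List ℕ → List ℕ → ℕ
  invAfter U []       = 0
  invAfter U (x ∷ xs) = count (x <ᵇℕ_) U + invAfter (U ∷ʳ x) xs

  inv-∷ʳ : ∀ U x → inv (U ∷ʳ x) ≡ inv U + count (x <ᵇℕ_) U
  inv-∷ʳ []      x = refl
  inv-∷ʳ (u ∷ U) x rewrite count-∷ʳ (_<ᵇℕ u) U x | inv-∷ʳ U x = interchange (count (_<ᵇℕ u) U) _ _ _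

  inv-++ : ∀ U xs → inv (U ++ xs) ≡ inv U + invAfter U xs
  inv-++ U []       rewrite ListP.++-identityʳ U = sym (ℕP.+-identityʳ _)
  inv-++ U (x ∷ xs) rewrite sym (ListP.∷ʳ-++ U x xs) | inv-++ (U ∷ʳ x) xs | inv-∷ʳ U x =
    ℕP.+-assoc (inv U) _ _

  infix 4 _⇔ᵇ_

  _⇔ᵇ_ : Bool → Bool → Bool
  a ⇔ᵇ b = if a then b else not b

  even-suc : ∀ m → even (suc m) ≡ not (even m)
  even-suc zero          = refl
  even-suc (suc zero)    = refl
  even-suc (suc (suc m)) = even-suc m

  negateIf : ℤ → Bool → Bool
  negateIf a e = if a <ᵇ + 0 then not e else e

  even-negs-∷ : ∀ a w e → (even (negs (a ∷ w)) ⇔ᵇ e) ≡ (even (negs w) ⇔ᵇ negateIf a e)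
  even-negs-∷ a w e with a <ᵇ + 0
  ... | false = refl
  ... | true rewrite even-suc (negs w) with even (negs w)
  ...   | true  = refl
  ...   | false = sym (BoolP.not-involutive e)

  ⇔ᵇ-true : ∀ b → b ≡ (b ⇔ᵇ true)
  ⇔ᵇ-true true  = refl
  ⇔ᵇ-true false = refl

  ⇔ᵇ-false : ∀ b → not b ≡ (b ⇔ᵇ false)
  ⇔ᵇ-false true  = refl
  ⇔ᵇ-false false = refl

open Combinatorics
open import Data.Nat using (zero; suc; _∸_; _<_; _≤_; z≤n; s≤s) renaming (_<ᵇ_ to _<ᵇℕ_)
import Data.Nat.Properties as ℕP
open import Data.Bool using (Bool; true; false; if_then_else_; not; _∧_; T?)
import Data.Integer as ℤ
open import Data.Integer using (ℤ; +_; -[1+_]; ∣_∣)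
open import Data.List using (List; []; _∷_; map; concatMap; applyUpTo; length; filter; _++_; [_]; _∷ʳ_)
import Data.List.Properties as ListP
open import Data.List.Relation.Unary.Unique.DecPropositional ℕP._≟_ using (unique?)
open import Data.Product using (_,_)
open import Data.Sum using (_⊎_; inj₁; inj₂)
open import Data.Empty using (⊥-elim)
open import Relation.Binary.Definitions using (tri<; tri≈; tri>)
open import Relation.Nullary using (Dec; does)
import Relation.Binary.PropositionalEquality as ≡
open ≡ using (_≡_; _≢_)

module Sums {c ℓ : Level} (R : CommutativeRing c ℓ) where
  open CommutativeRing R
  open import Relation.Binary.Reasoning.Setoid setoid
  open import Algebra.Properties.CommutativeSemigroup +-commutativeSemigroup
    using () renaming (interchange to +-interchange)

  sumMap : {A : Set} → (A → Carrier) → List A → Carrier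
  sumMap f xs = sumR R (map f xs)

  sumMap-cong : {A : Set} {f g : A → Carrier} → (∀ x → f x ≈ g x) → ∀ xs → sumMap f xs ≈ sumMap g xs
  sumMap-cong f≈g []       = refl
  sumMap-cong f≈g (x ∷ xs) = +-cong (f≈g x) (sumMap-cong f≈g xs)

  sumMap-zero : {A : Set} {f : A → Carrier} → (∀ x → f x ≈ 0#) → ∀ xs → sumMap f xs ≈ 0#
  sumMap-zero f≈0 []       = refl
  sumMap-zero f≈0 (x ∷ xs) = trans (+-cong (f≈0 x) (sumMap-zero f≈0 xs)) (+-identityˡ 0#)

  sumMap-++ : {A : Set} (f : A → Carrier) (xs ys : List A) → sumMap f (xs ++ ys) ≈ sumMap f xs + sumMap f ys
  sumMap-++ f []       ys = sym (+-identityˡ _)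
  sumMap-++ f (x ∷ xs) ys = trans (+-congˡ (sumMap-++ f xs ys)) (sym (+-assoc _ _ _))

  sumMap-concatMap : {A B : Set} (f : B → Carrier) (g : A → List B) (xs : List A) →
                     sumMap f (concatMap g xs) ≈ sumMap (λ x → sumMap f (g x)) xs
  sumMap-concatMap f g []       = refl
  sumMap-concatMap f g (x ∷ xs) =
    trans (sumMap-++ f (g x) (concatMap g xs)) (+-congˡ (sumMap-concatMap f g xs))

  sumMap-map : {A B : Set} (f : B → Carrier) (g : A → B) (xs : List A) → sumMap f (map g xs) ≡ sumMap (λ x → f (g x)) xs
  sumMap-map f g []       = ≡.refl
  sumMap-map f g (x ∷ xs) = ≡.cong (λ z → f (g x) + z) (sumMap-map f g xs)

  sumMap-filter : {A : Set} {p : Level} {P : A → Set p} (P? : ∀ x → Dec (P x)) (f : A → Carrier) (xs : List A) →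
                  sumMap f (filter P? xs) ≈ sumMap (λ x → if does (P? x) then f x else 0#) xs
  sumMap-filter P? f []       = refl
  sumMap-filter P? f (x ∷ xs) with does (P? x)
  ... | true  = +-congˡ (sumMap-filter P? f xs)
  ... | false = trans (sumMap-filter P? f xs) (sym (+-identityˡ _))

  *-distribˡ-sumMap : {A : Set} (a : Carrier) (f : A → Carrier) (xs : List A) →
                      a * sumMap f xs ≈ sumMap (λ x → a * f x) xs
  *-distribˡ-sumMap a f []       = zeroʳ a
  *-distribˡ-sumMap a f (x ∷ xs) = trans (distribˡ a _ _) (+-congˡ (*-distribˡ-sumMap a f xs))

  sumMap-unless : {A : Set} (b : Bool) (a : Carrier) (f : A → Carrier) (xs : List A) →
                  sumMap (λ x → if b then 0# else a * f x) xs ≈ (if b then 0# else a * sumMap f xs)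
  sumMap-unless true  a f xs = sumMap-zero (λ _ → refl) xs
  sumMap-unless false a f xs = sym (*-distribˡ-sumMap a f xs)

  sumMap-words : {A : Set} (f : List A → Carrier) (k : ℕ) (as : List A) →
                 sumMap f (words (suc k) as) ≈ sumMap (λ a → sumMap (λ w → f (a ∷ w)) (words k as)) as
  sumMap-words f k as = trans (sumMap-concatMap f (λ a → map (a ∷_) (words k as)) as)
                              (sumMap-cong (λ a → reflexive (sumMap-map f (a ∷_) (words k as))) as)

  sumTo : (ℕ → Carrier) → ℕ → Carrier
  sumTo g zero    = 0#
  sumTo g (suc n) = sumTo g n + g n

  sumTo-cong : ∀ {f g : ℕ → Carrier} {n} → (∀ i → i < n → f i ≈ g i) → ∀ m → m ≤ n → sumTo f m ≈ sumTo g m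
  sumTo-cong f≈g zero    _   = refl
  sumTo-cong f≈g (suc m) m<n = +-cong (sumTo-cong f≈g m (ℕP.<⇒≤ m<n)) (f≈g m m<n)

  sumTo-+ : (f g : ℕ → Carrier) (n : ℕ) → sumTo (λ i → f i + g i) n ≈ sumTo f n + sumTo g n
  sumTo-+ f g zero    = sym (+-identityˡ _)
  sumTo-+ f g (suc n) = trans (+-congʳ (sumTo-+ f g n)) (+-interchange _ _ _ _)

  *-distribˡ-sumTo : (a : Carrier) (f : ℕ → Carrier) (n : ℕ) → a * sumTo f n ≈ sumTo (λ i → a * f i) n
  *-distribˡ-sumTo a f zero    = zeroʳ a
  *-distribˡ-sumTo a f (suc n) = trans (distribˡ a _ _) (+-congʳ (*-distribˡ-sumTo a f n))

  sumMap-applyUpTo : (f : ℕ → ℤ) (h : ℤ → Carrier) (n : ℕ) → sumMap h (applyUpTo f n) ≈ sumTo (λ i → h (f i)) n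
  sumMap-applyUpTo f h zero    = refl
  sumMap-applyUpTo f h (suc n) = begin
    sumMap h (applyUpTo f (suc n))          ≡⟨ ≡.cong (sumMap h) (≡.sym (ListP.applyUpTo-∷ʳ f n)) ⟩
    sumMap h (applyUpTo f n ∷ʳ f n)         ≈⟨ sumMap-++ h (applyUpTo f n) [ f n ] ⟩
    sumMap h (applyUpTo f n) + (h (f n) + 0#) ≈⟨ +-cong (sumMap-applyUpTo f h n) (+-identityʳ _) ⟩
    sumTo (λ i → h (f i)) n + h (f n)       ∎

  sumMap-alphabet : (h : ℤ → Carrier) (n : ℕ) → sumMap h (alphabet n) ≈ sumTo (λ i → h -[1+ i ] + h (+ suc i)) n
  sumMap-alphabet h n = begin
    sumMap h (alphabet n)
      ≈⟨ sumMap-++ h (applyUpTo (λ i → ℤ.- (+ suc i)) n) _ ⟩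
    sumMap h (applyUpTo (λ i → ℤ.- (+ suc i)) n) + sumMap h (applyUpTo (λ i → + suc i) n)
      ≈⟨ +-cong (sumMap-applyUpTo (λ i → ℤ.- (+ suc i)) h n) (sumMap-applyUpTo (λ i → + suc i) h n) ⟩
    sumTo (λ i → h -[1+ i ]) n + sumTo (λ i → h (+ suc i)) n
      ≈⟨ sumTo-+ _ _ n ⟨
    sumTo (λ i → h -[1+ i ] + h (+ suc i)) n ∎

  sumTo-two : (H : ℕ → Carrier) (k : ℕ) → (∀ r → suc (suc r) ≤ suc k → H (suc (suc r)) ≈ 0#) →
              sumTo H (suc (suc k)) ≈ (0# + H 0) + H 1
  sumTo-two H zero    _    = refl
  sumTo-two H (suc k) H≈0 =
    trans (+-cong (sumTo-two H k (λ r r≤k → H≈0 r (ℕP.m≤n⇒m≤1+n r≤k))) (H≈0 k ℕP.≤-refl)) (+-identityʳ _)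

module SignedDescents {c ℓ : Level} (R : CommutativeRing c ℓ) (s t : CommutativeRing.Carrier R) where
  open CommutativeRing R
  open Sums R
  open import Relation.Binary.Reasoning.Setoid setoid
  open import Algebra.Properties.Ring ring
    using (-1*x≈-x; -‿involutive; -0#≈0#; -‿distribˡ-*; -‿distribʳ-*; ⁻¹-anti-homo‿-; -‿+-comm; x[y-z]≈xy-xz)
  open import Algebra.Properties.CommutativeSemigroup +-commutativeSemigroup
    using () renaming (interchange to +-interchange)
  open import Algebra.Properties.CommutativeSemigroup *-commutativeSemigroup
    using (x∙yz≈y∙xz) renaming (interchange to *-interchange)

  pow-+ : ∀ x a b → pow R x (a ℕ.+ b) ≈ pow R x a * pow R x b
  pow-+ x zero    b = sym (*-identityˡ _)
  pow-+ x (suc a) b = trans (*-congˡ (pow-+ x a b)) (sym (*-assoc _ _ _))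

  sign : ℕ → Carrier
  sign = pow R (- 1#)

  sign-2* : ∀ b → sign (2 ℕ.* b) ≈ 1#
  sign-2* zero    = refl
  sign-2* (suc b) = begin
    sign (2 ℕ.* suc b)             ≡⟨ ≡.cong sign (ℕP.*-suc 2 b) ⟩
    - 1# * (- 1# * sign (2 ℕ.* b)) ≈⟨ *-assoc _ _ _ ⟨
    (- 1# * - 1#) * sign (2 ℕ.* b) ≈⟨ *-cong (trans (-1*x≈-x (- 1#)) (-‿involutive 1#)) (sign-2* b) ⟩
    1# * 1#                        ≈⟨ *-identityˡ 1# ⟩
    1#                             ∎

  sign-+2* : ∀ a b → sign (a ℕ.+ 2 ℕ.* b) ≈ sign a
  sign-+2* a b = trans (pow-+ (- 1#) a (2 ℕ.* b)) (trans (*-congˡ (sign-2* b)) (*-identityʳ _))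

  stepWeight : ℤ → ℤ → Carrier
  stepWeight p a = if a <ᵇ p then t else s

  pathWeight : ℤ → List ℤ → Carrier
  pathWeight p []      = 1#
  pathWeight p (a ∷ w) = stepWeight p a * pathWeight a w

  desFrom≤length : ∀ p w → desFrom p w ℕ.≤ length w
  desFrom≤length p []      = z≤n
  desFrom≤length p (a ∷ w) with a <ᵇ p
  ... | true  = s≤s (desFrom≤length a w)
  ... | false = ℕP.m≤n⇒m≤1+n (desFrom≤length a w)

  ascDes-pathWeight : ∀ p w → pow R s (length w ∸ desFrom p w) * pow R t (desFrom p w) ≈ pathWeight p w
  ascDes-pathWeight p []      = *-identityˡ 1#
  ascDes-pathWeight p (a ∷ w) with a <ᵇ p
  ... | true  = trans (x∙yz≈y∙xz _ t _) (*-congˡ (ascDes-pathWeight a w))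
  ... | false = begin
    pow R s (suc (length w) ∸ desFrom a w) * pow R t (desFrom a w)
      ≡⟨ ≡.cong (λ m → pow R s m * pow R t (desFrom a w)) (ℕP.+-∸-assoc 1 (desFrom≤length a w)) ⟩
    (s * pow R s (length w ∸ desFrom a w)) * pow R t (desFrom a w)
      ≈⟨ *-assoc _ _ _ ⟩
    s * (pow R s (length w ∸ desFrom a w) * pow R t (desFrom a w))
      ≈⟨ *-congˡ (ascDes-pathWeight a w) ⟩
    s * pathWeight a w ∎

  -- The weight of the letters w appended to a prefix with absolute values U and last letter p;
  -- the sign counts the inversions each new letter forms with the earlier ones.
  signedWeight : List ℕ → ℤ → List ℤ → Carrier
  signedWeight U p []      = 1#
  signedWeight U p (a ∷ w) =
    (sign (count (∣ a ∣ <ᵇℕ_) U) * stepWeight p a) * signedWeight (U ∷ʳ ∣ a ∣) a w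

  signedWeight-factor : ∀ U p w → signedWeight U p w ≈ sign (invAfter U (map ∣_∣ w)) * pathWeight p w
  signedWeight-factor U p []      = sym (*-identityˡ 1#)
  signedWeight-factor U p (a ∷ w) = begin
    (sign (count (∣ a ∣ <ᵇℕ_) U) * stepWeight p a) * signedWeight (U ∷ʳ ∣ a ∣) a w
      ≈⟨ *-congˡ (signedWeight-factor (U ∷ʳ ∣ a ∣) a w) ⟩
    (sign (count (∣ a ∣ <ᵇℕ_) U) * stepWeight p a) * (sign (invAfter (U ∷ʳ ∣ a ∣) (map ∣_∣ w)) * pathWeight a w)
      ≈⟨ *-interchange _ _ _ _ ⟩
    (sign (count (∣ a ∣ <ᵇℕ_) U) * sign (invAfter (U ∷ʳ ∣ a ∣) (map ∣_∣ w))) * (stepWeight p a * pathWeight a w)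
      ≈⟨ *-congʳ (pow-+ (- 1#) (count (∣ a ∣ <ᵇℕ_) U) _) ⟨
    sign (invAfter U (map ∣_∣ (a ∷ w))) * pathWeight p (a ∷ w) ∎

  term≈signedWeight : ∀ w → uniqueᵇ (map ∣_∣ w) ≡ true → term R s t w ≈ signedWeight [] (+ 0) w
  term≈signedWeight w u = begin
    (sign (invD w) * pow R s (ascB w)) * pow R t (desB w)
      ≈⟨ *-assoc _ _ _ ⟩
    sign (invD w) * (pow R s (ascB w) * pow R t (desB w))
      ≈⟨ *-cong (reflexive (≡.cong sign (invD-parity w u))) (ascDes-pathWeight (+ 0) w) ⟩
    sign (inv (map ∣_∣ w) ℕ.+ 2 ℕ.* negAboveCount w) * pathWeight (+ 0) w
      ≈⟨ *-congʳ (sign-+2* (inv (map ∣_∣ w)) (negAboveCount w)) ⟩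
    sign (inv (map ∣_∣ w)) * pathWeight (+ 0) w
      ≡⟨ ≡.cong (λ m → sign m * pathWeight (+ 0) w) (inv-++ [] (map ∣_∣ w)) ⟩
    sign (invAfter [] (map ∣_∣ w)) * pathWeight (+ 0) w
      ≈⟨ signedWeight-factor [] (+ 0) w ⟨
    signedWeight [] (+ 0) w ∎

  -- Ψ e k c ng is the signed weight of all ways to place k more letters once the k unused
  -- absolute values are relabelled 0,…,k-1: the last letter placed has c unused values below it
  -- and is negative iff ng, and the new negative letters must have parity e. A new letter of
  -- rank r forms r inversions with the smaller values still to come, whence sign r.

  stepToPos : ℕ → ℕ → Bool → Carrier
  stepToPos r c ng = if ng then s else (if r <ᵇℕ c then t else s)

  stepToNeg : ℕ → ℕ → Bool → Carrier
  stepToNeg r c ng = if ng then (if r <ᵇℕ c then s else t) else t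

  Ψ      : Bool → ℕ → ℕ → Bool → Carrier
  Ψ-term : Bool → ℕ → ℕ → Bool → ℕ → Carrier
  Ψ e zero    c ng = if e then 1# else 0#
  Ψ e (suc k) c ng = sumTo (Ψ-term e k c ng) (suc k)
  Ψ-term e k c ng r = sign r * (stepToPos r c ng * Ψ e k r false + stepToNeg r c ng * Ψ (not e) k r true)

  Placed : List ℕ → ℤ → Set
  Placed U p = p ≡ + 0 ⊎ (∣ p ∣ ∈ᵇ U) ≡ true

  stepWeight-pos : ∀ U p i → Placed U p → (suc i ∈ᵇ U) ≡ false →
                   stepWeight p (+ suc i) ≡ stepToPos (rank U (suc i)) (rank U ∣ p ∣) (p <ᵇ + 0)
  stepWeight-pos U .(+ 0)  i (inj₁ ≡.refl) _ = ≡.refl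
  stepWeight-pos U (+ zero)  i (inj₂ _) _ = ≡.refl
  stepWeight-pos U (+ suc q) i (inj₂ q∈U) i∉U =
    ≡.cong (λ b → if b then t else s) (rank-<ᵇ U i (suc q) i∉U (∈ᵇ-≢ U i∉U q∈U))
  stepWeight-pos U -[1+ q ]  i (inj₂ _) _ = ≡.refl

  stepWeight-neg : ∀ U p i → Placed U p → (suc i ∈ᵇ U) ≡ false →
                   stepWeight p -[1+ i ] ≡ stepToNeg (rank U (suc i)) (rank U ∣ p ∣) (p <ᵇ + 0)
  stepWeight-neg U .(+ 0)  i (inj₁ ≡.refl) _ = ≡.refl
  stepWeight-neg U (+ zero)  i (inj₂ _) _ = ≡.refl
  stepWeight-neg U (+ suc q) i (inj₂ _) _ = ≡.refl
  stepWeight-neg U -[1+ q ]  i (inj₂ q∈U) i∉U = ≡.trans flip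
    (≡.cong (λ b → if b then s else t) (rank-<ᵇ U i (suc q) i∉U (∈ᵇ-≢ U i∉U q∈U)))
    where
    flip : (if q <ᵇℕ i then t else s) ≡ (if i <ᵇℕ q then s else t)
    flip with ℕP.<-cmp i q
    ... | tri≈ _ i≡q _ = ⊥-elim (∈ᵇ-≢ U i∉U q∈U (≡.cong suc i≡q))
    ... | tri< i<q _ _ rewrite <ᵇ-true i<q | <ᵇ-false (ℕP.<⇒≤ i<q) = ≡.refl
    ... | tri> _ _ q<i rewrite <ᵇ-true q<i | <ᵇ-false (ℕP.<⇒≤ q<i) = ≡.refl

  sumTo-free : ∀ U (H : ℕ → Carrier) j →
    sumTo (λ i → if suc i ∈ᵇ U then 0# else H (rank U (suc i))) j ≈ sumTo H (freeUpTo U j)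
  sumTo-free U H zero    = refl
  sumTo-free U H (suc j) with suc j ∈ᵇ U
  ... | true  = trans (+-identityʳ _) (trans (sumTo-free U H j)
                  (reflexive (≡.cong (sumTo H) (≡.sym (ℕP.+-identityʳ (freeUpTo U j))))))
  ... | false = trans (+-congʳ (sumTo-free U H j)) (reflexive (≡.cong (sumTo H) (ℕP.+-comm 1 (freeUpTo U j))))

  module Completions (n : ℕ) where

    admissible : List ℕ → Bool → List ℤ → Bool
    admissible U e w = uniqueᵇ (U ++ map ∣_∣ w) ∧ (even (negs w) ⇔ᵇ e)

    summand : List ℕ → ℤ → Bool → List ℤ → Carrier
    summand U p e w = if admissible U e w then signedWeight U p w else 0#

    completionSum : ℕ → List ℕ → ℤ → Bool → Carrier
    completionSum k U p e = sumMap (summand U p e) (words k (alphabet n))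

    extension : List ℕ → ℤ → ℤ → Carrier → Carrier
    extension U p a x = if ∣ a ∣ ∈ᵇ U then 0# else (sign (count (∣ a ∣ <ᵇℕ_) U) * stepWeight p a) * x

    summand-∷ : ∀ U p e a w →
                summand U p e (a ∷ w) ≈ extension U p a (summand (U ∷ʳ ∣ a ∣) a (negateIf a e) w)
    summand-∷ U p e a w rewrite uniqueᵇ-++-∷ ∣ a ∣ U (map ∣_∣ w) | even-negs-∷ a w e with ∣ a ∣ ∈ᵇ U
    ... | true  = refl
    ... | false with admissible (U ∷ʳ ∣ a ∣) (negateIf a e) w
    ...   | true  = refl
    ...   | false = sym (zeroʳ _)

    completionSum-suc : ∀ k U p e → completionSum (suc k) U p e ≈
      sumMap (λ a → extension U p a (completionSum k (U ∷ʳ ∣ a ∣) a (negateIf a e))) (alphabet n)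
    completionSum-suc k U p e =
      trans (sumMap-words (summand U p e) k (alphabet n))
            (sumMap-cong (λ a → trans (sumMap-cong (summand-∷ U p e a) (words k (alphabet n)))
                                      (sumMap-unless (∣ a ∣ ∈ᵇ U) _ _ (words k (alphabet n))))
                         (alphabet n))

    potential : List ℕ → Carrier
    potential U = sign (pendingInv U n)

    potential-∷ʳ : ∀ U i → suc i ℕ.≤ n → (suc i ∈ᵇ U) ≡ false →
      sign (count (suc i <ᵇℕ_) U) * potential (U ∷ʳ suc i) ≈ potential U * sign (rank U (suc i))
    potential-∷ʳ U i i≤n i∉U = begin
      sign (count (suc i <ᵇℕ_) U) * sign (pendingInv (U ∷ʳ suc i) n)
        ≈⟨ *-comm _ _ ⟩
      sign (pendingInv (U ∷ʳ suc i) n) * sign (count (suc i <ᵇℕ_) U)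
        ≈⟨ pow-+ (- 1#) (pendingInv (U ∷ʳ suc i) n) _ ⟨
      sign (pendingInv (U ∷ʳ suc i) n ℕ.+ count (suc i <ᵇℕ_) U)
        ≡⟨ ≡.cong sign (pendingInv-∷ʳ U n i≤n i∉U) ⟩
      sign (pendingInv U n ℕ.+ rank U (suc i))
        ≈⟨ pow-+ (- 1#) (pendingInv U n) _ ⟩
      potential U * sign (rank U (suc i)) ∎

    CompletionInvariant : ℕ → Set ℓ
    CompletionInvariant k = ∀ U p e → uniqueᵇ U ≡ true → freeUpTo U n ≡ k → Placed U p →
      completionSum k U p e ≈ potential U * Ψ e k (rank U ∣ p ∣) (p <ᵇ + 0)

    extensions-± : ∀ k → CompletionInvariant k → ∀ U p e → uniqueᵇ U ≡ true → freeUpTo U n ≡ suc k →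
      Placed U p → ∀ i → i ℕ.< n →
      extension U p -[1+ i ] (completionSum k (U ∷ʳ suc i) -[1+ i ] (not e))
        + extension U p (+ suc i) (completionSum k (U ∷ʳ suc i) (+ suc i) e)
      ≈ potential U * (if suc i ∈ᵇ U then 0# else Ψ-term e k (rank U ∣ p ∣) (p <ᵇ + 0) (rank U (suc i)))
    extensions-± k IH U p e uU free placed i i<n with suc i ∈ᵇ U in i∈U
    ... | true  = trans (+-identityˡ 0#) (sym (zeroʳ _))
    ... | false = begin
      (σ * stepWeight p -[1+ i ]) * completionSum k U′ -[1+ i ] (not e)
        + (σ * stepWeight p (+ suc i)) * completionSum k U′ (+ suc i) e
        ≈⟨ +-cong (*-cong (*-congˡ (reflexive (stepWeight-neg U p i placed i∈U)))
                          (IH U′ -[1+ i ] (not e) uU′ free′ (inj₂ (∈ᵇ-∷ʳ-self U (suc i)))))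
                  (*-cong (*-congˡ (reflexive (stepWeight-pos U p i placed i∈U)))
                          (IH U′ (+ suc i) e uU′ free′ (inj₂ (∈ᵇ-∷ʳ-self U (suc i))))) ⟩
      (σ * down) * (potential U′ * Ψ (not e) k (rank U′ (suc i)) true)
        + (σ * up) * (potential U′ * Ψ e k (rank U′ (suc i)) false)
        ≡⟨ ≡.cong (λ r → (σ * down) * (potential U′ * Ψ (not e) k r true)
                         + (σ * up) * (potential U′ * Ψ e k r false))
                  (freeUpTo-∷ʳ-< U i (ℕP.n<1+n i)) ⟩
      (σ * down) * (potential U′ * Ψ (not e) k r true) + (σ * up) * (potential U′ * Ψ e k r false)
        ≈⟨ +-cong (*-interchange _ _ _ _) (*-interchange _ _ _ _) ⟩
      (σ * potential U′) * (down * Ψ (not e) k r true) + (σ * potential U′) * (up * Ψ e k r false)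
        ≈⟨ distribˡ _ _ _ ⟨
      (σ * potential U′) * (down * Ψ (not e) k r true + up * Ψ e k r false)
        ≈⟨ *-cong (potential-∷ʳ U i i<n i∈U) (+-comm _ _) ⟩
      (potential U * sign r) * (up * Ψ e k r false + down * Ψ (not e) k r true)
        ≈⟨ *-assoc _ _ _ ⟩
      potential U * Ψ-term e k (rank U ∣ p ∣) (p <ᵇ + 0) r ∎
      where
      U′ = U ∷ʳ suc i
      r = rank U (suc i)
      σ = sign (count (suc i <ᵇℕ_) U)
      up = stepToPos r (rank U ∣ p ∣) (p <ᵇ + 0)
      down = stepToNeg r (rank U ∣ p ∣) (p <ᵇ + 0)
      uU′ : uniqueᵇ U′ ≡ true
      uU′ = uniqueᵇ-∷ʳ U (suc i) uU i∈U
      free′ : freeUpTo U′ n ≡ k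
      free′ = ℕP.suc-injective (≡.trans (freeUpTo-∷ʳ-≥ U n i<n i∈U) free)

    completionSum≈Ψ : ∀ k → CompletionInvariant k
    completionSum≈Ψ zero U p e uU none _
      rewrite ListP.++-identityʳ U | uU | pendingInv-no-free U n none
      = trans (+-identityʳ _) (sym (*-identityˡ _))
    completionSum≈Ψ (suc k) U p e uU free placed = begin
      completionSum (suc k) U p e
        ≈⟨ completionSum-suc k U p e ⟩
      sumMap G (alphabet n)
        ≈⟨ sumMap-alphabet G n ⟩
      sumTo (λ i → G -[1+ i ] + G (+ suc i)) n
        ≈⟨ sumTo-cong (extensions-± k (completionSum≈Ψ k) U p e uU free placed) n ℕP.≤-refl ⟩
      sumTo (λ i → potential U * (if suc i ∈ᵇ U then 0# else H (rank U (suc i)))) n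
        ≈⟨ *-distribˡ-sumTo (potential U) _ n ⟨
      potential U * sumTo (λ i → if suc i ∈ᵇ U then 0# else H (rank U (suc i))) n
        ≈⟨ *-congˡ (sumTo-free U H n) ⟩
      potential U * sumTo H (freeUpTo U n)
        ≡⟨ ≡.cong (λ m → potential U * sumTo H m) free ⟩
      potential U * Ψ e (suc k) (rank U ∣ p ∣) (p <ᵇ + 0) ∎
      where
      G : ℤ → Carrier
      G a = extension U p a (completionSum k (U ∷ʳ ∣ a ∣) a (negateIf a e))
      H : ℕ → Carrier
      H = Ψ-term e k (rank U ∣ p ∣) (p <ᵇ + 0)

    completionSum-start : ∀ e → completionSum n [] (+ 0) e ≈ Ψ e n 0 false
    completionSum-start e = begin
      completionSum n [] (+ 0) e
        ≈⟨ completionSum≈Ψ n [] (+ 0) e ≡.refl (freeUpTo-[] n) (inj₁ ≡.refl) ⟩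
      sign (pendingInv [] n) * Ψ e n 0 false
        ≡⟨ ≡.cong (λ m → sign m * Ψ e n 0 false) (pendingInv-[] n) ⟩
      1# * Ψ e n 0 false
        ≈⟨ *-identityˡ _ ⟩
      Ψ e n 0 false ∎

    sumMap-B-parity : ∀ e (keep : List ℤ → Bool) → (∀ w → keep w ≡ (even (negs w) ⇔ᵇ e)) →
      sumMap (term R s t) (filter (λ w → T? (keep w)) (B n)) ≈ Ψ e n 0 false
    sumMap-B-parity e keep keep≡ = begin
      sumMap (term R s t) (filter (λ w → T? (keep w)) (B n))
        ≈⟨ sumMap-filter (λ w → T? (keep w)) (term R s t) (B n) ⟩
      sumMap (λ w → if does (T? (keep w)) then term R s t w else 0#) (B n)
        ≈⟨ sumMap-filter (λ w → unique? (map ∣_∣ w)) _ (words n (alphabet n)) ⟩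
      sumMap (λ w → if does (unique? (map ∣_∣ w))
                    then (if does (T? (keep w)) then term R s t w else 0#) else 0#) (words n (alphabet n))
        ≈⟨ sumMap-cong summand≈ (words n (alphabet n)) ⟩
      completionSum n [] (+ 0) e
        ≈⟨ completionSum-start e ⟩
      Ψ e n 0 false ∎
      where
      summand≈ : ∀ w → (if does (unique? (map ∣_∣ w))
                        then (if does (T? (keep w)) then term R s t w else 0#) else 0#)
                       ≈ summand [] (+ 0) e w
      summand≈ w rewrite does-unique? (map ∣_∣ w) | keep≡ w
        with uniqueᵇ (map ∣_∣ w) in u | even (negs w) ⇔ᵇ e
      ... | true  | true  = term≈signedWeight w u
      ... | true  | false = refl
      ... | false | _     = refl

  d : Carrier
  d = s - t

  closedCoeff : Bool → Bool → ℕ → Bool → Carrier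
  closedCoeff b e zero          ng = if b then (if e then s else t) else (if e then d else 0#)
  closedCoeff b e (suc zero)    ng = if ng then s else (if b then t else - t)
  closedCoeff b e (suc (suc c)) ng = 0#

  -- The terms r = 0, 1 of Ψ e (k + 2) c ng divided by d ^ k; the terms r ≥ 2 vanish.
  stepCombination : Bool → Bool → ℕ → Bool → Carrier
  stepCombination b e c ng =
    (stepToPos 0 c ng * closedCoeff b e 0 false + stepToNeg 0 c ng * closedCoeff b (not e) 0 true)
    - (stepToPos 1 c ng * closedCoeff b e 1 false + stepToNeg 1 c ng * closedCoeff b (not e) 1 true)

  x-y≈0*d : ∀ {x y} → x ≈ y → x - y ≈ 0# * d
  x-y≈0*d {x} x≈y = trans (+-congˡ (-‿cong (sym x≈y))) (trans (-‿inverseʳ x) (sym (zeroˡ d)))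

  x-0≈x : ∀ {x y} → y ≈ 0# → x - y ≈ x
  x-0≈x y≈0 = trans (+-congˡ (trans (-‿cong y≈0) -0#≈0#)) (+-identityʳ _)

  x+y*0≈x : ∀ x y → x + y * 0# ≈ x
  x+y*0≈x x y = trans (+-congˡ (zeroʳ y)) (+-identityʳ x)

  y*0+x≈x : ∀ x y → y * 0# + x ≈ x
  y*0+x≈x x y = trans (+-congʳ (zeroʳ y)) (+-identityˡ x)

  [a+b]-[b+c]≈a-c : ∀ a b c → (a + b) - (b + c) ≈ a - c
  [a+b]-[b+c]≈a-c a b c = begin
    (a + b) - (b + c)     ≈⟨ +-congˡ (-‿cong (+-comm b c)) ⟩
    (a + b) - (c + b)     ≈⟨ +-congˡ (-‿+-comm c b) ⟨
    (a + b) + (- c + - b) ≈⟨ +-interchange a b (- c) (- b) ⟩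
    (a - c) + (b - b)     ≈⟨ +-congˡ (-‿inverseʳ b) ⟩
    (a - c) + 0#          ≈⟨ +-identityʳ _ ⟩
    a - c                 ∎

  x*d : ∀ x → x * s - x * t ≈ x * d
  x*d x = sym (x[y-z]≈xy-xz x s t)

  t*t-t*s : t * t - t * s ≈ - t * d
  t*t-t*s = begin
    t * t - t * s     ≈⟨ ⁻¹-anti-homo‿- (t * s) (t * t) ⟨
    - (t * s - t * t) ≈⟨ -‿cong (x[y-z]≈xy-xz t s t) ⟨
    - (t * d)         ≈⟨ -‿distribˡ-* t d ⟩
    - t * d           ∎

  square-d : (s * s + t * t) - (s * t + t * s) ≈ d * d
  square-d = begin
    (s * s + t * t) - (s * t + t * s)     ≈⟨ +-congˡ (-‿+-comm (s * t) (t * s)) ⟨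
    (s * s + t * t) + (- (s * t) + - (t * s)) ≈⟨ +-interchange _ _ _ _ ⟩
    (s * s - s * t) + (t * t - t * s)     ≈⟨ +-cong (x*d s) t*t-t*s ⟩
    s * d + - t * d                       ≈⟨ distribʳ d s (- t) ⟨
    d * d                                 ∎

  s-row : (s * s + s * t) - (s * t + t * s) ≈ s * d
  s-row = trans ([a+b]-[b+c]≈a-c (s * s) (s * t) (t * s)) (trans (+-congˡ (-‿cong (*-comm t s))) (x*d s))

  t-row : (t * t + t * s) - (s * t + t * s) ≈ - t * d
  t-row = trans (+-congˡ (-‿cong (+-congʳ (*-comm s t)))) (trans ([a+b]-[b+c]≈a-c (t * t) (t * s) (t * s)) t*t-t*s)

  cross≈0 : s * - t + t * s ≈ 0#
  cross≈0 = trans (+-cong (sym (-‿distribʳ-* s t)) (*-comm t s)) (-‿inverseˡ (s * t))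

  row≈x*d : ∀ x → x * - t + x * s ≈ x * d
  row≈x*d x = trans (+-comm _ _) (sym (distribˡ x s (- t)))

  stepCombination≈ : ∀ b e c ng → stepCombination b e c ng ≈ closedCoeff (not b) e c ng * d
  stepCombination≈ true  true  zero          true  = square-d
  stepCombination≈ true  true  zero          false = square-d
  stepCombination≈ true  false zero          ng    = x-y≈0*d refl
  stepCombination≈ true  true  (suc zero)    false = trans (+-congʳ (+-comm _ _)) t-row
  stepCombination≈ true  false (suc zero)    false = t-row
  stepCombination≈ true  true  (suc zero)    true  = s-row
  stepCombination≈ true  false (suc zero)    true  = trans (+-congʳ (+-comm _ _)) s-row
  stepCombination≈ true  true  (suc (suc c)) ng    = x-y≈0*d (+-comm _ _)
  stepCombination≈ true  false (suc (suc c)) ng    = x-y≈0*d refl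
  stepCombination≈ false true  zero          true  = trans (x-0≈x cross≈0) (x+y*0≈x _ _)
  stepCombination≈ false true  zero          false = trans (x-0≈x cross≈0) (x+y*0≈x _ _)
  stepCombination≈ false false zero          true  = trans (x-0≈x cross≈0) (y*0+x≈x _ _)
  stepCombination≈ false false zero          false = trans (x-0≈x cross≈0) (y*0+x≈x _ _)
  stepCombination≈ false true  (suc zero)    true  = trans (x-0≈x cross≈0) (x+y*0≈x _ _)
  stepCombination≈ false true  (suc zero)    false = trans (x-0≈x cross≈0) (x+y*0≈x _ _)
  stepCombination≈ false false (suc zero)    true  = trans (x-0≈x cross≈0) (y*0+x≈x _ _)
  stepCombination≈ false false (suc zero)    false = trans (x-0≈x cross≈0) (y*0+x≈x _ _)
  stepCombination≈ false true  (suc (suc c)) ng    = x-y≈0*d (trans (x+y*0≈x _ _) (sym (row≈x*d _)))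
  stepCombination≈ false false (suc (suc c)) ng    = x-y≈0*d (trans (y*0+x≈x _ _) (sym (row≈x*d _)))

  twoTerms≈ : ∀ a x b y a′ x′ b′ y′ Q →
    (0# + sign 0 * (a * (x * Q) + b * (y * Q))) + sign 1 * (a′ * (x′ * Q) + b′ * (y′ * Q))
    ≈ ((a * x + b * y) - (a′ * x′ + b′ * y′)) * Q
  twoTerms≈ a x b y a′ x′ b′ y′ Q = begin
    (0# + 1# * (a * (x * Q) + b * (y * Q))) + (- 1# * 1#) * (a′ * (x′ * Q) + b′ * (y′ * Q))
      ≈⟨ +-cong (trans (+-identityˡ _) (trans (*-identityˡ _) (pair a x b y)))
                (*-cong (*-identityʳ (- 1#)) (pair a′ x′ b′ y′)) ⟩
    (a * x + b * y) * Q + - 1# * ((a′ * x′ + b′ * y′) * Q)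
      ≈⟨ +-congˡ (trans (-1*x≈-x _) (-‿distribˡ-* _ Q)) ⟩
    (a * x + b * y) * Q + - (a′ * x′ + b′ * y′) * Q
      ≈⟨ distribʳ Q _ _ ⟨
    ((a * x + b * y) - (a′ * x′ + b′ * y′)) * Q ∎
    where
    pair : ∀ a x b y → a * (x * Q) + b * (y * Q) ≈ (a * x + b * y) * Q
    pair a x b y = trans (+-cong (sym (*-assoc a x Q)) (sym (*-assoc b y Q))) (sym (distribʳ Q _ _))

  Ψ-closed-base : ∀ x y e → 0# + 1# * (x * (if e then 1# else 0#) + y * (if not e then 1# else 0#)) ≈ (if e then x else y) * 1#
  Ψ-closed-base x y true  = trans (+-identityˡ _) (trans (*-identityˡ _) (x+y*0≈x _ _))
  Ψ-closed-base x y false = trans (+-identityˡ _) (trans (*-identityˡ _) (y*0+x≈x _ _))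

  Ψ-closed : ∀ k e c ng → c ℕ.≤ suc k → Ψ e (suc k) c ng ≈ closedCoeff (even k) e c ng * pow R d k
  Ψ-closed zero    e     zero          true  _ = Ψ-closed-base s t e
  Ψ-closed zero    e     zero          false _ = Ψ-closed-base s t e
  Ψ-closed zero    true  (suc zero)    ng    _ = Ψ-closed-base _ _ true
  Ψ-closed zero    false (suc zero)    ng    _ = Ψ-closed-base _ _ false
  Ψ-closed zero    e     (suc (suc c)) ng    (s≤s ())
  Ψ-closed (suc k) e     c             ng    _ = begin
    Ψ e (suc (suc k)) c ng
      ≈⟨ sumTo-two (Ψ-term e (suc k) c ng) k vanish ⟩
    (0# + Ψ-term e (suc k) c ng 0) + Ψ-term e (suc k) c ng 1
      ≈⟨ +-cong (+-congˡ (*-congˡ (+-cong (*-congˡ (IH e 0 false z≤n)) (*-congˡ (IH (not e) 0 true z≤n)))))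
                (*-congˡ (+-cong (*-congˡ (IH e 1 false (s≤s z≤n))) (*-congˡ (IH (not e) 1 true (s≤s z≤n))))) ⟩
    (0# + sign 0 * (P 0 * (γ e 0 false * Q) + N 0 * (γ (not e) 0 true * Q)))
      + sign 1 * (P 1 * (γ e 1 false * Q) + N 1 * (γ (not e) 1 true * Q))
      ≈⟨ twoTerms≈ _ _ _ _ _ _ _ _ Q ⟩
    stepCombination (even k) e c ng * Q
      ≈⟨ *-congʳ (stepCombination≈ (even k) e c ng) ⟩
    (closedCoeff (not (even k)) e c ng * d) * Q
      ≈⟨ *-assoc _ d Q ⟩
    closedCoeff (not (even k)) e c ng * pow R d (suc k)
      ≡⟨ ≡.cong (λ b → closedCoeff b e c ng * pow R d (suc k)) (≡.sym (even-suc k)) ⟩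
    closedCoeff (even (suc k)) e c ng * pow R d (suc k) ∎
    where
    Q = pow R d k
    γ = closedCoeff (even k)
    P = λ r → stepToPos r c ng
    N = λ r → stepToNeg r c ng
    IH : ∀ e r ng′ → r ℕ.≤ suc k → Ψ e (suc k) r ng′ ≈ γ e r ng′ * Q
    IH e r ng′ = Ψ-closed k e r ng′
    vanish : ∀ r → suc (suc r) ℕ.≤ suc k → Ψ-term e (suc k) c ng (suc (suc r)) ≈ 0#
    vanish r r≤k = trans (*-congˡ (trans (+-cong (*-congˡ (trans (IH e _ false r≤k) (zeroˡ Q)))
                                                 (*-congˡ (trans (IH (not e) _ true r≤k) (zeroˡ Q))))
                                         (trans (+-cong (zeroʳ _) (zeroʳ _)) (+-identityʳ 0#))))
                         (zeroʳ _)

  Ψ-shift : ∀ m e → Ψ e (suc (suc m)) 0 false ≈ pow R d 2 * Ψ e m 0 false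
  Ψ-shift zero    true  = trans (Ψ-closed 1 true 0 false z≤n) (sym (*-identityʳ _))
  Ψ-shift zero    false = trans (Ψ-closed 1 false 0 false z≤n) (trans (zeroˡ _) (sym (zeroʳ _)))
  Ψ-shift (suc j) e     = begin
    Ψ e (suc (suc (suc j))) 0 false        ≈⟨ Ψ-closed (suc (suc j)) e 0 false z≤n ⟩
    γ * (d * (d * pow R d j))              ≈⟨ *-congˡ (*-assoc d d _) ⟨
    γ * ((d * d) * pow R d j)              ≈⟨ x∙yz≈y∙xz γ (d * d) _ ⟩
    (d * d) * (γ * pow R d j)              ≈⟨ *-cong (*-congˡ (*-identityʳ d)) (Ψ-closed j e 0 false z≤n) ⟨
    pow R d 2 * Ψ e (suc j) 0 false        ∎
    where γ = closedCoeff (even j) e 0 false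

  Ψ-even : ∀ j e → Ψ e (2 ℕ.* j) 0 false ≈ (if e then pow R d (2 ℕ.* j) else 0#)
  Ψ-even zero    e = refl
  Ψ-even (suc j) e = begin
    Ψ e (2 ℕ.* suc j) 0 false                    ≡⟨ ≡.cong (λ m → Ψ e m 0 false) (ℕP.*-suc 2 j) ⟩
    Ψ e (2 ℕ.+ 2 ℕ.* j) 0 false                  ≈⟨ Ψ-shift (2 ℕ.* j) e ⟩
    pow R d 2 * Ψ e (2 ℕ.* j) 0 false            ≈⟨ *-congˡ (Ψ-even j e) ⟩
    pow R d 2 * (if e then pow R d (2 ℕ.* j) else 0#) ≈⟨ d²* e ⟩
    (if e then pow R d (2 ℕ.* suc j) else 0#)    ∎
    where
    d²* : ∀ e → pow R d 2 * (if e then pow R d (2 ℕ.* j) else 0#) ≈ (if e then pow R d (2 ℕ.* suc j) else 0#)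
    d²* true  = trans (sym (pow-+ d 2 (2 ℕ.* j))) (reflexive (≡.cong (pow R d) (≡.sym (ℕP.*-suc 2 j))))
    d²* false = zeroʳ _

  Ψ-odd : ∀ j e → Ψ e (2 ℕ.* j ℕ.+ 1) 0 false ≈ (if e then s else t) * pow R d (2 ℕ.* j)
  Ψ-odd zero    e = Ψ-closed 0 e 0 false z≤n
  Ψ-odd (suc j) e = begin
    Ψ e (2 ℕ.* suc j ℕ.+ 1) 0 false            ≡⟨ ≡.cong (λ m → Ψ e (m ℕ.+ 1) 0 false) (ℕP.*-suc 2 j) ⟩
    Ψ e (2 ℕ.+ (2 ℕ.* j ℕ.+ 1)) 0 false        ≈⟨ Ψ-shift (2 ℕ.* j ℕ.+ 1) e ⟩
    pow R d 2 * Ψ e (2 ℕ.* j ℕ.+ 1) 0 false    ≈⟨ *-congˡ (Ψ-odd j e) ⟩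
    pow R d 2 * (x * pow R d (2 ℕ.* j))         ≈⟨ x∙yz≈y∙xz _ x _ ⟩
    x * (pow R d 2 * pow R d (2 ℕ.* j))         ≈⟨ *-congˡ (pow-+ d 2 (2 ℕ.* j)) ⟨
    x * pow R d (2 ℕ.+ 2 ℕ.* j)                 ≡⟨ ≡.cong (λ m → x * pow R d m) (≡.sym (ℕP.*-suc 2 j)) ⟩
    x * pow R d (2 ℕ.* suc j)                   ∎
    where x = if e then s else t

  SgnBDesD≈Ψ : ∀ n → SgnBDesD R n s t ≈ Ψ true n 0 false
  SgnBDesD≈Ψ n = Completions.sumMap-B-parity n true (λ w → even (negs w)) (λ w → ⇔ᵇ-true (even (negs w)))

  SgnBDesBD≈Ψ : ∀ n → SgnBDesBD R n s t ≈ Ψ false n 0 false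
  SgnBDesBD≈Ψ n = Completions.sumMap-B-parity n false (λ w → not (even (negs w))) (λ w → ⇔ᵇ-false (even (negs w)))

theorem5p10 : {c ℓ : Level} (R : CommutativeRing c ℓ) →
    let open CommutativeRing R in
    (s t : Carrier) →
    ((n : ℕ) → n ℕ.≥ 2 →
      (SgnBDesD R n s t ≈ pow R (s - t) 2 * SgnBDesD R (n ℕ.∸ 2) s t)
      × (SgnBDesBD R n s t ≈ pow R (s - t) 2 * SgnBDesBD R (n ℕ.∸ 2) s t))
    × ((k : ℕ) → k ℕ.≥ 1 →
      (SgnBDesD R (2 ℕ.* k) s t ≈ pow R (s - t) (2 ℕ.* k))
      × (SgnBDesBD R (2 ℕ.* k) s t ≈ 0#))
    × ((k : ℕ) →
      (SgnBDesD R (2 ℕ.* k ℕ.+ 1) s t ≈ s * pow R (s - t) (2 ℕ.* k))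
      × (SgnBDesBD R (2 ℕ.* k ℕ.+ 1) s t ≈ t * pow R (s - t) (2 ℕ.* k)))
theorem5p10 R s t =
    (λ { (suc zero) (s≤s ())
       ; (suc (suc m)) _ →
           trans (SgnBDesD≈Ψ (suc (suc m))) (trans (Ψ-shift m true) (*-congˡ (sym (SgnBDesD≈Ψ m))))
         , trans (SgnBDesBD≈Ψ (suc (suc m))) (trans (Ψ-shift m false) (*-congˡ (sym (SgnBDesBD≈Ψ m)))) })
  , (λ k _ → trans (SgnBDesD≈Ψ (2 ℕ.* k)) (Ψ-even k true) , trans (SgnBDesBD≈Ψ (2 ℕ.* k)) (Ψ-even k false))
  , (λ k → trans (SgnBDesD≈Ψ (2 ℕ.* k ℕ.+ 1)) (Ψ-odd k true) , trans (SgnBDesBD≈Ψ (2 ℕ.* k ℕ.+ 1)) (Ψ-odd k false))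
  where
  open CommutativeRing R
  open SignedDescents R s t
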